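{- Let $w\ge 2$ and $m,n\in A_w$. Then $p(m)=p(n)$ if and only if $K(m)=K(n)$.
   Context: Fix $w\ge 2$. A $w$-digit number is a string $a_1a_2\dots a_w$ of decimal digits $0\le a_i\le 9$ (leading zeros allowed), identified with the integer it represents. $A_w$ denotes the set of $w$-digit numbers whose digits are not all identical. For a $w$-digit number $n$, $O_d(n)=x_1x_2\dots x_w$ is the number obtained by sorting its digits in non-increasing order ($x_1\ge x_2\ge\dots\ge x_w$) and $O_u(n)=x_wx_{w-1}\dots x_1$ the number obtained by sorting them in non-decreasing order. The Kaprekar map is $K(n)=O_d(n)-O_u(n)$, the result being written again as a $w$-digit string (padding with leading zeros). Let $h=\lfloor w/2\rfloor$. The parameters of $n$ are $p(n)=(\alpha^1,\alpha^2,\dots,\alpha^h)$ with $\alpha^s=x_s-x_{w-s+1}$ for $1\le s\le h$, where $x_1\ge\dots\ge x_w$ are the sorted digits of $n$. -}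

module Defs where

open import Data.Nat using (ℕ; _+_; _*_; _∸_; _/_)
open import Data.Nat.Properties using (≤-decTotalOrder)
open import Data.Fin using (Fin; toℕ)
open import Data.Vec using (Vec; toList)
open import Data.List using (List; []; _∷_; map; reverse; zipWith; take; foldl; length)
open import Data.List.Relation.Unary.All using (All)
open import Data.List.Relation.Unary.Any using (Any)
open import Relation.Binary.PropositionalEquality using (_≢_)
open import Data.Product using (_×_; ∃)
import Data.List.Sort.InsertionSort as IS
open IS ≤-decTotalOrder using (sort)

-- A w-digit number: a string a₁a₂…a_w of decimal digits (leading zeros allowed).
Digits : ℕ → Set
Digits w = Vec (Fin 10) w

digitList : ∀ {w} → Digits w → List ℕ
digitList n = map toℕ (toList n)

InA : ∀ {w} → Digits w → Set
InA n = Any (λ a → Any (λ b → a ≢ b) (digitList n)) (digitList n)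

value : List ℕ → ℕ
value = foldl (λ acc d → 10 * acc + d) 0

sortedDesc : ∀ {w} → Digits w → List ℕ
sortedDesc n = reverse (sort (digitList n))

Od : ∀ {w} → Digits w → ℕ
Od n = value (sortedDesc n)

Ou : ∀ {w} → Digits w → ℕ
Ou n = value (reverse (sortedDesc n))

-- Kaprekar map K(n) = O_d(n) - O_u(n) (as an integer; O_d(n) ≥ O_u(n)).
-- Equality of the padded w-digit strings is equality of these integers,
-- since 0 ≤ K(n) < 10^w.
K : ∀ {w} → Digits w → ℕ
K n = Od n ∸ Ou n

params : ∀ {w} → Digits w → List ℕ
params {w} n = take (w / 2) (zipWith _∸_ (sortedDesc n) (reverse (sortedDesc n)))

-- Writing x₁ ≥ … ≥ x_w for the sorted digits, pairing the s-th digit from either end gives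
--   K(n) = Σ_{s ≤ h} αˢ (10^{w−s} − 10^{s−1}),
-- so K is a function of the parameters. Conversely this sum is, modulo 10, −α¹ with
-- 0 ≤ α¹ ≤ 9, so K determines α¹; subtracting its term and dividing by 10 leaves the same
-- sum for the inner w − 2 digits, and induction recovers the remaining parameters.
module Submission where

open import Defs
open import Data.Nat using (ℕ; _≥_)
open import Relation.Binary.PropositionalEquality using (_≡_)
open import Data.Product using (_×_)

open import Data.Nat using (zero; suc; _+_; _*_; _∸_; _^_; _≤_; _<_; _/_; _%_; _⊓_; z≤n; s≤s; NonZero)
open import Data.Nat.Properties
open import Data.Nat.DivMod using ([m+kn]%n≡m%n; m<n⇒m%n≡m; m/n≤m; m/n≡1+[m∸n]/n)
open import Data.Nat.Solver using (module +-*-Solver)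
open import Data.Fin using (toℕ)
open import Data.Fin.Properties using (toℕ<n)
open import Data.Vec using (toList)
open import Data.Vec.Properties using (length-toList)
open import Data.List using (List; []; _∷_; _++_; _∷ʳ_; [_]; map; reverse; zipWith; take; foldl; length; initLast; _∷ʳ′_)
open import Data.List.Properties using (length-++; length-map; length-take; length-zipWith; length-reverse; reverse-involutive; reverse-++; unfold-reverse; foldl-∷ʳ)
open import Data.List.Relation.Unary.All using (All; []; _∷_; universal)
import Data.List.Relation.Unary.All.Properties as All
open import Data.List.Relation.Unary.AllPairs using (AllPairs; []; _∷_)
open import Data.List.Relation.Unary.Linked.Properties using (Linked⇒AllPairs)
open import Data.List.Relation.Binary.Permutation.Propositional using (↭-sym)
open import Data.List.Relation.Binary.Permutation.Propositional.Properties using (All-resp-↭; ↭-reverse; ↭-length)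
open import Data.List.Sort.InsertionSort.Properties ≤-decTotalOrder using (sort-↭; sort-↗)
open import Data.Product using (_,_)
open import Data.Empty using (⊥-elim)
open import Relation.Binary.PropositionalEquality using (refl; sym; trans; cong; cong₂; module ≡-Reasoning)
import Data.List.Sort.InsertionSort as IS
open IS ≤-decTotalOrder using (sort)
open +-*-Solver using (solve; _:+_; _:*_; _:=_; con)
open ≡-Reasoning

private
  variable
    A B C : Set
    k : ℕ

length-∷ʳ : ∀ (xs : List A) x → length (xs ∷ʳ x) ≡ suc (length xs)
length-∷ʳ xs x = trans (length-++ xs) (+-comm (length xs) 1)

take-++ˡ : ∀ n (xs ys : List A) → n ≤ length xs → take n (xs ++ ys) ≡ take n xs
take-++ˡ zero    xs       ys _         = refl
take-++ˡ (suc n) (x ∷ xs) ys (s≤s n≤) = cong (x ∷_) (take-++ˡ n xs ys n≤)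

zipWith-∷ʳ : ∀ (f : A → B → C) xs ys x y → length xs ≡ length ys →
             zipWith f (xs ∷ʳ x) (ys ∷ʳ y) ≡ zipWith f xs ys ∷ʳ f x y
zipWith-∷ʳ f []       []       x y _  = refl
zipWith-∷ʳ f (a ∷ xs) (b ∷ ys) x y eq = cong (f a b ∷_) (zipWith-∷ʳ f xs ys x y (suc-injective eq))

reverse-outer : ∀ (b : A) M a → reverse (b ∷ M ∷ʳ a) ≡ a ∷ reverse M ∷ʳ b
reverse-outer b M a = trans (unfold-reverse b (M ∷ʳ a)) (cong (_∷ʳ b) (reverse-++ M [ a ]))

AllPairs-init : ∀ {R : A → A → Set} xs {a} → AllPairs R (xs ∷ʳ a) → AllPairs R xs
AllPairs-init []       _          = []
AllPairs-init (x ∷ xs) (px ∷ pxs) = All.++⁻ˡ xs px ∷ AllPairs-init xs pxs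

All-last : ∀ {P : A → Set} xs {a} → All P (xs ∷ʳ a) → P a
All-last []       (pa ∷ _)  = pa
All-last (x ∷ xs) (_ ∷ pxs) = All-last xs pxs

zipWith-∸-< : ∀ {c} (xs ys : List ℕ) → All (_< c) xs → All (_< c) (zipWith _∸_ xs ys)
zipWith-∸-< []       _        _          = []
zipWith-∸-< (x ∷ xs) []       _          = []
zipWith-∸-< (x ∷ xs) (y ∷ ys) (px ∷ pxs) = ≤-<-trans (m∸n≤m x y) px ∷ zipWith-∸-< xs ys pxs

ss/2 : ∀ k → suc (suc k) / 2 ≡ suc (k / 2)
ss/2 k = m/n≡1+[m∸n]/n {suc (suc k)} {2} (s≤s (s≤s z≤n))

remainder-unique : ∀ {a b} q r n .{{_ : NonZero n}} → a < n → b < n → a + q * n ≡ b + r * n → a ≡ b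
remainder-unique {a} {b} q r n a<n b<n eq = begin
  a               ≡⟨ sym (m<n⇒m%n≡m a<n) ⟩
  a % n           ≡⟨ sym ([m+kn]%n≡m%n a q n) ⟩
  (a + q * n) % n ≡⟨ cong (_% n) eq ⟩
  (b + r * n) % n ≡⟨ [m+kn]%n≡m%n b r n ⟩
  b % n           ≡⟨ m<n⇒m%n≡m b<n ⟩
  b               ∎

value-∷ : ∀ a xs → value (a ∷ xs) ≡ a * 10 ^ length xs + value xs
value-∷ a xs = foldl-acc a xs
  where
  foldl-acc : ∀ acc xs → foldl (λ acc d → 10 * acc + d) acc xs ≡ acc * 10 ^ length xs + value xs
  foldl-acc acc []       = sym (trans (+-identityʳ _) (*-identityʳ acc))
  foldl-acc acc (x ∷ xs) = begin
    foldl _ (10 * acc + x) xs                               ≡⟨ foldl-acc (10 * acc + x) xs ⟩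
    (10 * acc + x) * 10 ^ length xs + value xs              ≡⟨ solve 4 (λ a y p v → (con 10 :* a :+ y) :* p :+ v
                                                                  := a :* (con 10 :* p) :+ (y :* p :+ v)) refl acc x (10 ^ length xs) (value xs) ⟩
    acc * 10 ^ suc (length xs) + (x * 10 ^ length xs + value xs) ≡⟨ cong (acc * 10 ^ suc (length xs) +_) (sym (foldl-acc x xs)) ⟩
    acc * 10 ^ suc (length xs) + value (x ∷ xs)             ∎

value-∷ʳ : ∀ xs b → value (xs ∷ʳ b) ≡ 10 * value xs + b
value-∷ʳ xs b = foldl-∷ʳ _ 0 b xs

value-outer : ∀ a M b → value (a ∷ M ∷ʳ b) ≡ a * 10 ^ suc (length M) + (10 * value M + b)
value-outer a M b = trans (value-∷ a (M ∷ʳ b))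
  (cong₂ (λ ℓ v → a * 10 ^ ℓ + v) (length-∷ʳ M b) (value-∷ʳ M b))

nines : ℕ → ℕ
nines k = 10 ^ suc k ∸ 1

nines+1 : ∀ k → nines k + 1 ≡ 10 ^ suc k
nines+1 k = m∸n+n≡m (m^n>0 10 (suc k))

-- Σₛ αˢ (10^{w−s} − 10^{s−1}): the outer pair weighs 10^{w−1} − 1 and the inner w − 2
-- digits contribute ten times the same sum for them.
fromParams : ℕ → List ℕ → ℕ
fromParams (suc (suc k)) (α ∷ ps) = α * nines k + 10 * fromParams k ps
fromParams _             _        = 0

paramsOfAscending : ℕ → List ℕ → List ℕ
paramsOfAscending w S = take (w / 2) (zipWith _∸_ (reverse S) S)

paramsOfAscending-outer : ∀ b M a → length M ≡ k →
  paramsOfAscending (suc (suc k)) (b ∷ M ∷ʳ a) ≡ (a ∸ b) ∷ paramsOfAscending k M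
paramsOfAscending-outer {k = k} b M a |M| = begin
  take (suc (suc k) / 2) (zipWith _∸_ (reverse (b ∷ M ∷ʳ a)) (b ∷ M ∷ʳ a))
    ≡⟨ cong₂ (λ h r → take h (zipWith _∸_ r (b ∷ M ∷ʳ a))) (ss/2 k) (reverse-outer b M a) ⟩
  (a ∸ b) ∷ take (k / 2) (zipWith _∸_ (reverse M ∷ʳ b) (M ∷ʳ a))
    ≡⟨ cong (λ zs → (a ∸ b) ∷ take (k / 2) zs) (zipWith-∷ʳ _∸_ (reverse M) M b a (length-reverse M)) ⟩
  (a ∸ b) ∷ take (k / 2) (zipWith _∸_ (reverse M) M ∷ʳ (b ∸ a))
    ≡⟨ cong ((a ∸ b) ∷_) (take-++ˡ (k / 2) _ _ k/2≤) ⟩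
  (a ∸ b) ∷ paramsOfAscending k M ∎
  where
  k/2≤ : k / 2 ≤ length (zipWith _∸_ (reverse M) M)
  k/2≤ = ≤-trans (m/n≤m k 2) (≤-reflexive (sym (begin
    length (zipWith _∸_ (reverse M) M) ≡⟨ length-zipWith _∸_ (reverse M) M ⟩
    length (reverse M) ⊓ length M      ≡⟨ cong (_⊓ length M) (length-reverse M) ⟩
    length M ⊓ length M                ≡⟨ ⊓-idem (length M) ⟩
    length M                           ≡⟨ |M| ⟩
    k                                  ∎)))

-- The semiring identity behind one peeling step, with a = b + d and 10^{k+1} = N + 1.
outer-pair-identity : ∀ b d N vM g →
  (b + d) * (N + 1) + (10 * (vM + g) + b) ≡ (b * (N + 1) + (10 * vM + (b + d))) + (d * N + 10 * g)
outer-pair-identity = solve 5 (λ b d N vM g →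
  (b :+ d) :* (N :+ con 1) :+ (con 10 :* (vM :+ g) :+ b)
    := (b :* (N :+ con 1) :+ (con 10 :* vM :+ (b :+ d))) :+ (d :* N :+ con 10 :* g)) refl

value-reverse-ascending : ∀ w S → length S ≡ w → AllPairs _≤_ S →
  value (reverse S) ≡ value S + fromParams w (paramsOfAscending w S)
value-reverse-ascending zero          []          _ _ = refl
value-reverse-ascending (suc zero)    (x ∷ [])    _ _ = sym (+-identityʳ (value [ x ]))
value-reverse-ascending (suc (suc k)) (b ∷ S′) |S| (b≤ ∷ ascS′) with initLast S′
value-reverse-ascending (suc (suc k)) (b ∷ .(M ∷ʳ a)) |S| (b≤ ∷ ascS′) | M ∷ʳ′ a = begin
  value (reverse (b ∷ M ∷ʳ a))                              ≡⟨ cong value (reverse-outer b M a) ⟩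
  value (a ∷ reverse M ∷ʳ b)                                ≡⟨ value-outer a (reverse M) b ⟩
  a * 10 ^ suc (length (reverse M)) + (10 * value (reverse M) + b)
    ≡⟨ cong₂ (λ ℓ v → a * 10 ^ suc ℓ + (10 * v + b)) (trans (length-reverse M) |M|) IH ⟩
  a * 10 ^ suc k + (10 * (value M + g) + b)                 ≡⟨ cong (λ P → a * P + (10 * (value M + g) + b)) (sym (nines+1 k)) ⟩
  a * (nines k + 1) + (10 * (value M + g) + b)              ≡⟨ cong (λ x → x * (nines k + 1) + (10 * (value M + g) + b)) (sym b+d≡a) ⟩
  (b + d) * (nines k + 1) + (10 * (value M + g) + b)        ≡⟨ outer-pair-identity b d (nines k) (value M) g ⟩
  (b * (nines k + 1) + (10 * value M + (b + d))) + (d * nines k + 10 * g)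
    ≡⟨ cong₂ (λ P x → (b * P + (10 * value M + x)) + (d * nines k + 10 * g)) (nines+1 k) b+d≡a ⟩
  (b * 10 ^ suc k + (10 * value M + a)) + fromParams (suc (suc k)) (d ∷ paramsOfAscending k M)
    ≡⟨ cong₂ (λ ℓ ps → (b * 10 ^ suc ℓ + (10 * value M + a)) + fromParams (suc (suc k)) ps)
         (sym |M|) (sym (paramsOfAscending-outer b M a |M|)) ⟩
  (b * 10 ^ suc (length M) + (10 * value M + a)) + fromParams (suc (suc k)) outerParams
    ≡⟨ cong (_+ fromParams (suc (suc k)) outerParams) (sym (value-outer b M a)) ⟩
  value (b ∷ M ∷ʳ a) + fromParams (suc (suc k)) outerParams ∎
  where
  d : ℕ
  d = a ∸ b
  g : ℕ
  g = fromParams k (paramsOfAscending k M)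
  outerParams : List ℕ
  outerParams = paramsOfAscending (suc (suc k)) (b ∷ M ∷ʳ a)
  |M| : length M ≡ k
  |M| = suc-injective (trans (sym (length-∷ʳ M a)) (suc-injective |S|))
  b+d≡a : b + d ≡ a
  b+d≡a = m+[n∸m]≡n (All-last M b≤)
  IH : value (reverse M) ≡ value M + g
  IH = value-reverse-ascending k M |M| (AllPairs-init M ascS′)

fromParams-+-head : ∀ k α ps → fromParams (suc (suc k)) (α ∷ ps) + α ≡ (α * 10 ^ k + fromParams k ps) * 10
fromParams-+-head k α ps = begin
  α * nines k + 10 * G + α   ≡⟨ solve 3 (λ a N g → a :* N :+ con 10 :* g :+ a := a :* (N :+ con 1) :+ con 10 :* g) refl α (nines k) G ⟩
  α * (nines k + 1) + 10 * G ≡⟨ cong (λ P → α * P + 10 * G) (nines+1 k) ⟩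
  α * (10 * 10 ^ k) + 10 * G ≡⟨ solve 3 (λ a P g → a :* (con 10 :* P) :+ con 10 :* g := (a :* P :+ g) :* con 10) refl α (10 ^ k) G ⟩
  (α * 10 ^ k + G) * 10      ∎
  where
  G : ℕ
  G = fromParams k ps

fromParams-head-injective : ∀ k α β ps qs → α < 10 → β < 10 →
  fromParams (suc (suc k)) (α ∷ ps) ≡ fromParams (suc (suc k)) (β ∷ qs) → α ≡ β
fromParams-head-injective k α β ps qs α<10 β<10 eq =
  sym (remainder-unique (α * 10 ^ k + fromParams k ps) (β * 10 ^ k + fromParams k qs) 10 β<10 α<10 (begin
  β + (α * 10 ^ k + fromParams k ps) * 10 ≡⟨ cong (β +_) (sym (fromParams-+-head k α ps)) ⟩
  β + (Gα + α)                            ≡⟨ cong (λ x → β + (x + α)) eq ⟩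
  β + (Gβ + α)                            ≡⟨ solve 3 (λ b g a → b :+ (g :+ a) := a :+ (g :+ b)) refl β Gβ α ⟩
  α + (Gβ + β)                            ≡⟨ cong (α +_) (fromParams-+-head k β qs) ⟩
  α + (β * 10 ^ k + fromParams k qs) * 10 ∎))
  where
  Gα Gβ : ℕ
  Gα = fromParams (suc (suc k)) (α ∷ ps)
  Gβ = fromParams (suc (suc k)) (β ∷ qs)

fromParams-injective : ∀ w ps qs → length ps ≡ w / 2 → length qs ≡ w / 2 →
  All (_< 10) ps → All (_< 10) qs → fromParams w ps ≡ fromParams w qs → ps ≡ qs
fromParams-injective zero          []       []       _   _   _            _            _  = refl
fromParams-injective (suc zero)    []       []       _   _   _            _            _  = refl
fromParams-injective (suc (suc k)) []       _        |p| _   _            _            _  = ⊥-elim (0≢1+n (trans |p| (ss/2 k)))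
fromParams-injective (suc (suc k)) (_ ∷ _)  []       _   |q| _            _            _  = ⊥-elim (0≢1+n (trans |q| (ss/2 k)))
fromParams-injective (suc (suc k)) (α ∷ ps) (β ∷ qs) |p| |q| (α<10 ∷ ps<) (β<10 ∷ qs<) eq
  = cong₂ _∷_ α≡β (fromParams-injective k ps qs
      (suc-injective (trans |p| (ss/2 k))) (suc-injective (trans |q| (ss/2 k))) ps< qs<
      (*-cancelˡ-≡ (fromParams k ps) (fromParams k qs) 10 (+-cancelˡ-≡ (α * nines k) _ _ tails≡)))
  where
  α≡β : α ≡ β
  α≡β = fromParams-head-injective k α β ps qs α<10 β<10 eq
  tails≡ : α * nines k + 10 * fromParams k ps ≡ α * nines k + 10 * fromParams k qs
  tails≡ = trans eq (cong (λ x → x * nines k + 10 * fromParams k qs) (sym α≡β))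

module _ {w : ℕ} (m : Digits w) where

  private
    S : List ℕ
    S = sort (digitList m)

  length-sortedDesc : length (sortedDesc m) ≡ w
  length-sortedDesc = begin
    length (reverse S)    ≡⟨ length-reverse S ⟩
    length S              ≡⟨ ↭-length (sort-↭ (digitList m)) ⟩
    length (digitList m)  ≡⟨ length-map toℕ (toList m) ⟩
    length (toList m)     ≡⟨ length-toList m ⟩
    w                     ∎

  sortedDesc-<10 : All (_< 10) (sortedDesc m)
  sortedDesc-<10 = All-resp-↭ (↭-sym (↭-reverse S))
    (All-resp-↭ (↭-sym (sort-↭ (digitList m))) (All.map⁺ (universal toℕ<n (toList m))))

  params-<10 : All (_< 10) (params m)
  params-<10 = All.take⁺ (w / 2) (zipWith-∸-< (sortedDesc m) _ sortedDesc-<10)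

  length-params : length (params m) ≡ w / 2
  length-params = begin
    length (params m)                                         ≡⟨ length-take (w / 2) _ ⟩
    w / 2 ⊓ length (zipWith _∸_ (reverse S) (reverse (reverse S)))
      ≡⟨ cong (w / 2 ⊓_) (length-zipWith _∸_ (reverse S) (reverse (reverse S))) ⟩
    w / 2 ⊓ (length (reverse S) ⊓ length (reverse (reverse S)))
      ≡⟨ cong (λ ℓ → w / 2 ⊓ (length (reverse S) ⊓ ℓ)) (length-reverse (reverse S)) ⟩
    w / 2 ⊓ (length (reverse S) ⊓ length (reverse S))         ≡⟨ cong (λ ℓ → w / 2 ⊓ (ℓ ⊓ ℓ)) length-sortedDesc ⟩
    w / 2 ⊓ (w ⊓ w)                                           ≡⟨ cong (w / 2 ⊓_) (⊓-idem w) ⟩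
    w / 2 ⊓ w                                                 ≡⟨ m≤n⇒m⊓n≡m (m/n≤m w 2) ⟩
    w / 2                                                     ∎

  K≡fromParams-params : K m ≡ fromParams w (params m)
  K≡fromParams-params = begin
    value (reverse S) ∸ value (reverse (reverse S))   ≡⟨ cong (λ xs → value (reverse S) ∸ value xs) (reverse-involutive S) ⟩
    value (reverse S) ∸ value S                       ≡⟨ cong (_∸ value S) (value-reverse-ascending w S |S| ascending) ⟩
    value S + fromParams w (paramsOfAscending w S) ∸ value S ≡⟨ m+n∸m≡n (value S) _ ⟩
    fromParams w (paramsOfAscending w S)
      ≡⟨ cong (λ xs → fromParams w (take (w / 2) (zipWith _∸_ (reverse S) xs))) (sym (reverse-involutive S)) ⟩
    fromParams w (params m)                           ∎
    where
    |S| : length S ≡ w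
    |S| = trans (sym (length-reverse S)) length-sortedDesc
    ascending : AllPairs _≤_ S
    ascending = Linked⇒AllPairs ≤-trans (sort-↗ (digitList m))

mainTheorem1 : (w : ℕ) → w ≥ 2 → (m n : Digits w) → InA m → InA n →
    (params m ≡ params n → K m ≡ K n) × (K m ≡ K n → params m ≡ params n)
mainTheorem1 w _ m n _ _ = K-from-params , params-from-K
  where
  K-from-params : params m ≡ params n → K m ≡ K n
  K-from-params p≡ = begin
    K m                    ≡⟨ K≡fromParams-params m ⟩
    fromParams w (params m) ≡⟨ cong (fromParams w) p≡ ⟩
    fromParams w (params n) ≡⟨ sym (K≡fromParams-params n) ⟩
    K n                    ∎
  params-from-K : K m ≡ K n → params m ≡ params n
  params-from-K K≡ = fromParams-injective w (params m) (params n)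
    (length-params m) (length-params n) (params-<10 m) (params-<10 n)
    (trans (sym (K≡fromParams-params m)) (trans K≡ (K≡fromParams-params n)))
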